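{- Define polynomials $F_n(z)$ by \[ \sum_{n\ge0}F_n(z)q^n=\prod_{n=1}^\infty\frac{(1+zq^n)^n}{(1-q^n)^{\lceil n/2\rceil}(1-z^2q^n)^{\lfloor n/2\rfloor}}. \] Then $[z^{k+1}]F_{n+1}(z)=[z^k]F_n(z)$ for all $n\ge0$ and $k\ge 2n/3$.
   Context: $[z^k]$ denotes coefficient extraction. -}

module Defs where

open import Data.Nat using (ℕ; zero; suc; _+_; _*_; _∸_; _≟_; ⌊_/2⌋; ⌈_/2⌉)
open import Data.Bool using (Bool; true; false; _∧_; if_then_else_)
open import Relation.Nullary.Decidable using (⌊_⌋)

-- Truncated bivariate formal power series with ℕ coefficients:
-- S n k = [q^n z^k] S.
Series : Set
Series = ℕ → ℕ → ℕ

sumTo : ℕ → (ℕ → ℕ) → ℕ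
sumTo zero    f = f 0
sumTo (suc n) f = sumTo n f + f (suc n)

one : Series
one zero zero = 1
one _    _    = 0

_⊛_ : Series → Series → Series
(f ⊛ g) n k = sumTo n λ i → sumTo k λ j → f i j * g (n ∸ i) (k ∸ j)

infixl 7 _⊛_

pow : Series → ℕ → Series
pow f zero    = one
pow f (suc e) = f ⊛ pow f e

prod : ℕ → (ℕ → Series) → Series
prod zero    F = one
prod (suc N) F = prod N F ⊛ F (suc N)

onePlusZQ : ℕ → Series
onePlusZQ m n k = (if ⌊ n ≟ 0 ⌋ ∧ ⌊ k ≟ 0 ⌋ then 1 else 0)
                + (if ⌊ n ≟ m ⌋ ∧ ⌊ k ≟ 1 ⌋ then 1 else 0)

-- 1 / (1 - z^d q^m) = Σ_{j ≥ 0} z^{d j} q^{m j}   (m ≥ 1; j ≤ n suffices)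
invOneMinus : ℕ → ℕ → Series
invOneMinus m d n k = sumTo n λ j → if ⌊ n ≟ m * j ⌋ ∧ ⌊ k ≟ d * j ⌋ then 1 else 0

factor : ℕ → Series
factor m = pow (onePlusZQ m) m ⊛ pow (invOneMinus m 0) ⌈ m /2⌉
                               ⊛ pow (invOneMinus m 2) ⌊ m /2⌋

-- [z^k] F_n(z) : the q^n coefficient of the infinite product only depends
-- on the factors with m ≤ n (the others are 1 + O(q^{n+1})).
coeffF : ℕ → ℕ → ℕ
coeffF n k = prod n factor n k

-- Say that a series vanishes above the line 2n = 3k if [q^n z^k] S = 0 whenever 2n < 3k, and that it is
-- shift-stable if [q^(n+1) z^(k+1)] S = [q^n z^k] S whenever 2n ≤ 3k, and [q^0 z^(k+1)] S = 0.
-- Multiplying a shift-stable series by one vanishing above the line preserves shift-stability: in the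
-- Cauchy product each term either has its second factor above the line, so it vanishes on both sides,
-- or has its first factor in the region where the shift is allowed. All factors with m ≥ 3 vanish above
-- the line, and so does 1/(1-q) · (1+zq^2)^2/(1-q^2); what is left of the factors m = 1, 2 is
-- (1+zq)/(1-z^2q^2) = 1/(1-zq), which is shift-stable. Finally the m-th factor is 1 + O(q^m), so the
-- coefficients of q^n and q^(n+1) are read off a finite product.

module Submission where

open import Defs
open import Algebra.Bundles using (CommutativeMonoid)
import Algebra.Solver.CommutativeMonoid as CommutativeMonoidSolver
open import Data.Bool using (_∧_; if_then_else_)
open import Data.Empty using (⊥; ⊥-elim)
open import Data.Fin using (zero; suc)
open import Data.Nat using (ℕ; zero; suc; _+_; _*_; _∸_; _≤_; _<_; z≤n; s≤s; _≟_; _<?_; ⌊_/2⌋; ⌈_/2⌉)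
open import Data.Nat.Properties
open import Data.Product using (_,_)
open import Data.Vec using ([]; _∷_)
open import Relation.Binary.PropositionalEquality
open import Relation.Nullary using (Dec; yes; no; ¬_)
open import Relation.Nullary.Decidable using (⌊_⌋)
open import Algebra.Properties.CommutativeSemigroup +-commutativeSemigroup using (interchange)

sum-cong : ∀ n {f g : ℕ → ℕ} → (∀ t → t ≤ n → f t ≡ g t) → sumTo n f ≡ sumTo n g
sum-cong zero    f≡g = f≡g 0 z≤n
sum-cong (suc n) f≡g = cong₂ _+_ (sum-cong n λ t t≤n → f≡g t (m≤n⇒m≤1+n t≤n)) (f≡g (suc n) ≤-refl)

sum-cong′ : ∀ n {f g : ℕ → ℕ} → (∀ t → f t ≡ g t) → sumTo n f ≡ sumTo n g
sum-cong′ n f≡g = sum-cong n λ t _ → f≡g t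

sum-zero : ∀ n {f : ℕ → ℕ} → (∀ t → t ≤ n → f t ≡ 0) → sumTo n f ≡ 0
sum-zero zero    f≡0 = f≡0 0 z≤n
sum-zero (suc n) f≡0 = cong₂ _+_ (sum-zero n λ t t≤n → f≡0 t (m≤n⇒m≤1+n t≤n)) (f≡0 (suc n) ≤-refl)

sum-head : ∀ n f → sumTo (suc n) f ≡ f 0 + sumTo n (λ t → f (suc t))
sum-head zero    f = refl
sum-head (suc n) f = trans (cong (_+ f (suc (suc n))) (sum-head n f)) (+-assoc (f 0) _ _)

sum-head-only : ∀ n f → (∀ t → t ≤ n → f (suc t) ≡ 0) → sumTo n f ≡ f 0
sum-head-only zero    f _      = refl
sum-head-only (suc n) f tail≡0 = begin
  sumTo (suc n) f                  ≡⟨ sum-head n f ⟩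
  f 0 + sumTo n (λ t → f (suc t))  ≡⟨ cong (f 0 +_) (sum-zero n λ t t≤n → tail≡0 t (m≤n⇒m≤1+n t≤n)) ⟩
  f 0 + 0                          ≡⟨ +-identityʳ (f 0) ⟩
  f 0                              ∎
  where open ≡-Reasoning

sum-+ : ∀ n f g → sumTo n (λ t → f t + g t) ≡ sumTo n f + sumTo n g
sum-+ zero    f g = refl
sum-+ (suc n) f g = trans (cong (_+ (f (suc n) + g (suc n))) (sum-+ n f g))
                          (interchange (sumTo n f) (sumTo n g) (f (suc n)) (g (suc n)))

sum-distribˡ : ∀ n f c → c * sumTo n f ≡ sumTo n (λ t → c * f t)
sum-distribˡ zero    f c = refl
sum-distribˡ (suc n) f c = trans (*-distribˡ-+ c (sumTo n f) (f (suc n))) (cong (_+ c * f (suc n)) (sum-distribˡ n f c))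

sum-distribʳ : ∀ n f c → sumTo n f * c ≡ sumTo n (λ t → f t * c)
sum-distribʳ zero    f c = refl
sum-distribʳ (suc n) f c = trans (*-distribʳ-+ c (sumTo n f) (f (suc n))) (cong (_+ f (suc n) * c) (sum-distribʳ n f c))

sum²-distribˡ : ∀ n m (F : ℕ → ℕ → ℕ) c → c * sumTo n (λ a → sumTo m (F a)) ≡ sumTo n (λ a → sumTo m (λ b → c * F a b))
sum²-distribˡ n m F c = trans (sum-distribˡ n (λ a → sumTo m (F a)) c) (sum-cong′ n λ a → sum-distribˡ m (F a) c)

sum²-distribʳ : ∀ n m (F : ℕ → ℕ → ℕ) c → sumTo n (λ a → sumTo m (F a)) * c ≡ sumTo n (λ a → sumTo m (λ b → F a b * c))
sum²-distribʳ n m F c = trans (sum-distribʳ n (λ a → sumTo m (F a)) c) (sum-cong′ n λ a → sum-distribʳ m (F a) c)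

sum-comm : ∀ n m (F : ℕ → ℕ → ℕ) → sumTo n (λ i → sumTo m (F i)) ≡ sumTo m (λ j → sumTo n (λ i → F i j))
sum-comm zero    m F = refl
sum-comm (suc n) m F = trans (cong (_+ sumTo m (F (suc n))) (sum-comm n m F))
                             (sym (sum-+ m (λ j → sumTo n (λ i → F i j)) (F (suc n))))

sum-reverse : ∀ n f → sumTo n f ≡ sumTo n (λ i → f (n ∸ i))
sum-reverse zero    f = refl
sum-reverse (suc n) f = begin
  sumTo n f + f (suc n)                  ≡⟨ cong (_+ f (suc n)) (sum-reverse n f) ⟩
  sumTo n (λ i → f (n ∸ i)) + f (suc n)  ≡⟨ +-comm _ (f (suc n)) ⟩
  f (suc n) + sumTo n (λ i → f (n ∸ i))  ≡⟨ sum-head n (λ i → f (suc n ∸ i)) ⟨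
  sumTo (suc n) (λ i → f (suc n ∸ i))    ∎
  where open ≡-Reasoning

sum-triangle : ∀ n (F : ℕ → ℕ → ℕ) →
  sumTo n (λ i → sumTo i (F i)) ≡ sumTo n (λ a → sumTo (n ∸ a) (λ c → F (a + c) a))
sum-triangle zero    F = refl
sum-triangle (suc n) F = begin
  sumTo n (λ i → sumTo i (F i)) + sumTo (suc n) (F (suc n))
    ≡⟨ cong (_+ sumTo (suc n) (F (suc n))) (sum-triangle n F) ⟩
  R n + (sumTo n (F (suc n)) + F (suc n) (suc n))
    ≡⟨ +-assoc (R n) _ _ ⟨
  (R n + sumTo n (F (suc n))) + F (suc n) (suc n)
    ≡⟨ cong₂ _+_ (sum-+ n (λ a → R′ n a) (F (suc n))) diagonal ⟨
  sumTo n (λ a → R′ n a + F (suc n) a) + R′ (suc n) (suc n)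
    ≡⟨ cong (_+ R′ (suc n) (suc n)) (sum-cong n extend) ⟩
  sumTo n (λ a → R′ (suc n) a) + R′ (suc n) (suc n)
    ∎
  where
  open ≡-Reasoning
  R′ : ℕ → ℕ → ℕ
  R′ m a = sumTo (m ∸ a) (λ c → F (a + c) a)
  R : ℕ → ℕ
  R m = sumTo m (R′ m)
  diagonal : R′ (suc n) (suc n) ≡ F (suc n) (suc n)
  diagonal rewrite n∸n≡0 n | +-identityʳ n = refl
  extend : ∀ a → a ≤ n → R′ n a + F (suc n) a ≡ R′ (suc n) a
  extend a a≤n rewrite +-∸-assoc 1 a≤n =
    cong (λ i → R′ n a + F i a) (sym (trans (+-suc a (n ∸ a)) (cong suc (m+[n∸m]≡n a≤n))))

infix 4 _≗₂_
_≗₂_ : Series → Series → Set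
f ≗₂ g = ∀ n k → f n k ≡ g n k

⊛-cong : ∀ {f f′ g g′} → f ≗₂ f′ → g ≗₂ g′ → f ⊛ g ≗₂ f′ ⊛ g′
⊛-cong f≗f′ g≗g′ n k = sum-cong′ n λ i → sum-cong′ k λ j → cong₂ _*_ (f≗f′ i j) (g≗g′ (n ∸ i) (k ∸ j))

⊛-comm : ∀ f g → f ⊛ g ≗₂ g ⊛ f
⊛-comm f g n k =
  trans (sum-reverse n _) (sum-cong n λ i i≤n → trans (sum-reverse k _) (sum-cong k λ j j≤k → swap i j i≤n j≤k))
  where
  swap : ∀ i j → i ≤ n → j ≤ k → f (n ∸ i) (k ∸ j) * g (n ∸ (n ∸ i)) (k ∸ (k ∸ j)) ≡ g i j * f (n ∸ i) (k ∸ j)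
  swap i j i≤n j≤k rewrite m∸[m∸n]≡n i≤n | m∸[m∸n]≡n j≤k = *-comm (f (n ∸ i) (k ∸ j)) (g i j)

⊛-identityˡ : ∀ f → one ⊛ f ≗₂ f
⊛-identityˡ f n k = trans (sum-head-only n _ λ _ _ → sum-zero k λ _ _ → refl)
                          (trans (sum-head-only k _ λ _ _ → refl) (+-identityʳ (f n k)))

⊛-identityʳ : ∀ f → f ⊛ one ≗₂ f
⊛-identityʳ f n k = trans (⊛-comm f one n k) (⊛-identityˡ f n k)

⊛-assoc : ∀ f g h → (f ⊛ g) ⊛ h ≗₂ f ⊛ (g ⊛ h)
⊛-assoc f g h n k = begin
  sumTo n (λ i → sumTo k (λ j → sumTo i (λ a → sumTo j (λ b → f a b * g (i ∸ a) (j ∸ b))) * h (n ∸ i) (k ∸ j)))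
    ≡⟨ sum-cong′ n (λ i → sum-cong′ k (λ j → sum²-distribʳ i j _ _)) ⟩
  sumTo n (λ i → sumTo k (λ j → sumTo i (λ a → sumTo j (λ b → T i a j b))))
    ≡⟨ sum-cong′ n (λ i → sum-comm k i (λ j a → sumTo j (λ b → T i a j b))) ⟩
  sumTo n (λ i → sumTo i (λ a → sumTo k (λ j → sumTo j (λ b → T i a j b))))
    ≡⟨ sum-triangle n (λ i a → sumTo k (λ j → sumTo j (λ b → T i a j b))) ⟩
  sumTo n (λ a → sumTo (n ∸ a) (λ c → sumTo k (λ j → sumTo j (λ b → T (a + c) a j b))))
    ≡⟨ sum-cong′ n (λ a → sum-cong′ (n ∸ a) (λ c → sum-triangle k (λ j b → T (a + c) a j b))) ⟩
  sumTo n (λ a → sumTo (n ∸ a) (λ c → sumTo k (λ b → sumTo (k ∸ b) (λ d → T (a + c) a (b + d) b))))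
    ≡⟨ sum-cong′ n (λ a → sum-comm (n ∸ a) k (λ c b → sumTo (k ∸ b) (λ d → T (a + c) a (b + d) b))) ⟩
  sumTo n (λ a → sumTo k (λ b → sumTo (n ∸ a) (λ c → sumTo (k ∸ b) (λ d → T (a + c) a (b + d) b))))
    ≡⟨ sum-cong′ n (λ a → sum-cong′ k (λ b → sum-cong′ (n ∸ a) (λ c → sum-cong′ (k ∸ b) (λ d → reindex a b c d)))) ⟩
  sumTo n (λ a → sumTo k (λ b → sumTo (n ∸ a) (λ c → sumTo (k ∸ b) (λ d → f a b * (g c d * h (n ∸ a ∸ c) (k ∸ b ∸ d))))))
    ≡⟨ sum-cong′ n (λ a → sum-cong′ k (λ b → sum²-distribˡ (n ∸ a) (k ∸ b) _ (f a b))) ⟨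
  sumTo n (λ a → sumTo k (λ b → f a b * sumTo (n ∸ a) (λ c → sumTo (k ∸ b) (λ d → g c d * h (n ∸ a ∸ c) (k ∸ b ∸ d)))))
    ∎
  where
  open ≡-Reasoning
  T : ℕ → ℕ → ℕ → ℕ → ℕ
  T i a j b = f a b * g (i ∸ a) (j ∸ b) * h (n ∸ i) (k ∸ j)
  reindex : ∀ a b c d → T (a + c) a (b + d) b ≡ f a b * (g c d * h (n ∸ a ∸ c) (k ∸ b ∸ d))
  reindex a b c d rewrite m+n∸m≡n a c | m+n∸m≡n b d | ∸-+-assoc n a c | ∸-+-assoc k b d =
    *-assoc (f a b) (g c d) (h (n ∸ (a + c)) (k ∸ (b + d)))

⊛-commutativeMonoid : CommutativeMonoid _ _
⊛-commutativeMonoid = record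
  { Carrier = Series
  ; _≈_ = _≗₂_
  ; _∙_ = _⊛_
  ; ε = one
  ; isCommutativeMonoid = record
    { isMonoid = record
      { isSemigroup = record
        { isMagma = record
          { isEquivalence = record
            { refl = λ _ _ → refl
            ; sym = λ f≗g n k → sym (f≗g n k)
            ; trans = λ f≗g g≗h n k → trans (f≗g n k) (g≗h n k)
            }
          ; ∙-cong = ⊛-cong
          }
        ; assoc = ⊛-assoc
        }
      ; identity = ⊛-identityˡ , ⊛-identityʳ
      }
    ; comm = ⊛-comm
    }
  }

indicator-∧-absurd : ∀ {P Q : Set} (p : Dec P) (q : Dec Q) → (P → Q → ⊥) →
                     (if ⌊ p ⌋ ∧ ⌊ q ⌋ then 1 else 0) ≡ 0
indicator-∧-absurd (yes p) (yes q) ¬pq = ⊥-elim (¬pq p q)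
indicator-∧-absurd (yes _) (no _)  _   = refl
indicator-∧-absurd (no _)  _       _   = refl

indicator-origin≡one : ∀ n k → (if ⌊ n ≟ 0 ⌋ ∧ ⌊ k ≟ 0 ⌋ then 1 else 0) ≡ one n k
indicator-origin≡one zero    zero    = refl
indicator-origin≡one zero    (suc k) = refl
indicator-origin≡one (suc n) k       = refl

⌊suc≟suc⌋ : ∀ m n → ⌊ suc m ≟ suc n ⌋ ≡ ⌊ m ≟ n ⌋
⌊suc≟suc⌋ m n with m ≟ n | suc m ≟ suc n
... | yes _   | yes _   = refl
... | no _    | no _    = refl
... | yes m≡n | no m≢n  = ⊥-elim (m≢n (cong suc m≡n))
... | no m≢n  | yes m≡n = ⊥-elim (m≢n (suc-injective m≡n))

*-≡0ʳ : ∀ m {n} → n ≡ 0 → m * n ≡ 0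
*-≡0ʳ m refl = *-zeroʳ m

*-split : ∀ c {i n} → i ≤ n → c * n ≡ c * i + c * (n ∸ i)
*-split c {i} {n} i≤n = trans (cong (c *_) (sym (m+[n∸m]≡n i≤n))) (*-distribˡ-+ c i (n ∸ i))

m+n<o+p⇒o≤m⇒n<p : ∀ m n o p → m + n < o + p → o ≤ m → n < p
m+n<o+p⇒o≤m⇒n<p m n o p lt o≤m = +-cancelˡ-< m n p (<-≤-trans lt (+-monoˡ-≤ p o≤m))

m+n≤o+p⇒p≤n⇒m≤o : ∀ m n o p → m + n ≤ o + p → p ≤ n → m ≤ o
m+n≤o+p⇒p≤n⇒m≤o m n o p le p≤n = +-cancelʳ-≤ n m o (≤-trans le (+-monoʳ-≤ o p≤n))

module Slope (a b : ℕ) where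

  VanishesAbove : Series → Set
  VanishesAbove S = ∀ n k → a * n < b * k → S n k ≡ 0

  record ShiftStable (S : Series) : Set where
    field
      shift       : ∀ n k → a * n ≤ b * k → S (suc n) (suc k) ≡ S n k
      q⁰-constant : ∀ k → S 0 (suc k) ≡ 0

  a*0≮b*0 : ¬ (a * 0 < b * 0)
  a*0≮b*0 = <-irrefl (trans (*-zeroʳ a) (sym (*-zeroʳ b)))

  one-vanishesAbove : VanishesAbove one
  one-vanishesAbove zero    zero    lt = ⊥-elim (a*0≮b*0 lt)
  one-vanishesAbove zero    (suc k) _  = refl
  one-vanishesAbove (suc n) k       _  = refl

  ⊛-vanishesAbove : ∀ {S T} → VanishesAbove S → VanishesAbove T → VanishesAbove (S ⊛ T)
  ⊛-vanishesAbove {S} {T} S-vanishes T-vanishes n k lt =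
    sum-zero n λ i i≤n → sum-zero k λ j j≤k → term-vanishes i j i≤n j≤k
    where
    term-vanishes : ∀ i j → i ≤ n → j ≤ k → S i j * T (n ∸ i) (k ∸ j) ≡ 0
    term-vanishes i j i≤n j≤k with a * i <? b * j
    ... | yes ai<bj = cong (_* T (n ∸ i) (k ∸ j)) (S-vanishes i j ai<bj)
    ... | no ai≮bj  = *-≡0ʳ (S i j) (T-vanishes (n ∸ i) (k ∸ j) rest-above)
      where
      rest-above : a * (n ∸ i) < b * (k ∸ j)
      rest-above = m+n<o+p⇒o≤m⇒n<p _ _ _ _ (subst₂ _<_ (*-split a i≤n) (*-split b j≤k) lt) (≮⇒≥ ai≮bj)

  pow-vanishesAbove : ∀ {S} → VanishesAbove S → ∀ e → VanishesAbove (pow S e)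
  pow-vanishesAbove S-vanishes zero    = one-vanishesAbove
  pow-vanishesAbove S-vanishes (suc e) = ⊛-vanishesAbove S-vanishes (pow-vanishesAbove S-vanishes e)

  onePlusZQ-vanishesAbove : ∀ m → b ≤ a * m → VanishesAbove (onePlusZQ m)
  onePlusZQ-vanishesAbove m b≤am n k lt =
    cong₂ _+_ (indicator-∧-absurd (n ≟ 0) (k ≟ 0) λ { refl refl → a*0≮b*0 lt })
              (indicator-∧-absurd (n ≟ m) (k ≟ 1) λ { refl refl → <⇒≱ (subst (a * m <_) (*-identityʳ b) lt) b≤am })

  invOneMinus-vanishesAbove : ∀ m d → b * d ≤ a * m → VanishesAbove (invOneMinus m d)
  invOneMinus-vanishesAbove m d bd≤am n k lt =
    sum-zero n λ t _ → indicator-∧-absurd (n ≟ m * t) (k ≟ d * t) λ { refl refl → <⇒≱ lt (along t) }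
    where
    along : ∀ t → b * (d * t) ≤ a * (m * t)
    along t = subst₂ _≤_ (*-assoc b d t) (*-assoc a m t) (*-monoˡ-≤ t bd≤am)

  factor-vanishesAbove : ∀ m → b * 2 ≤ a * m → VanishesAbove (factor m)
  factor-vanishesAbove m 2b≤am =
    ⊛-vanishesAbove (⊛-vanishesAbove (pow-vanishesAbove (onePlusZQ-vanishesAbove m b≤am) m)
                                     (pow-vanishesAbove (invOneMinus-vanishesAbove m 0 0≤am) ⌈ m /2⌉))
                    (pow-vanishesAbove (invOneMinus-vanishesAbove m 2 2b≤am) ⌊ m /2⌋)
    where
    0≤am : b * 0 ≤ a * m
    0≤am = subst (_≤ a * m) (sym (*-zeroʳ b)) z≤n
    b≤am : b ≤ a * m
    b≤am = ≤-trans (subst (_≤ b * 2) (*-identityʳ b) (*-monoʳ-≤ b (s≤s z≤n))) 2b≤am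

  ⊛-shiftStable : ∀ {S T} → a < b → ShiftStable S → VanishesAbove T → ShiftStable (S ⊛ T)
  ⊛-shiftStable {S} {T} a<b S-stable T-vanishes = record
    { shift       = shift′
    ; q⁰-constant = λ k → row₀-vanishes 0 k (≤-<-trans (a*0≤b*k k) (b*k<b*[1+k] k))
    }
    where
    open ShiftStable S-stable
    a*0≤b*k : ∀ k → a * 0 ≤ b * k
    a*0≤b*k k = subst (_≤ b * k) (sym (*-zeroʳ a)) z≤n
    b*k<b*[1+k] : ∀ k → b * k < b * suc k
    b*k<b*[1+k] k = subst (b * k <_) (sym (*-suc b k)) (+-monoˡ-< (b * k) (≤-<-trans z≤n a<b))
    row₀-vanishes : ∀ m k → a * m < b * suc k → sumTo (suc k) (λ j → S 0 j * T m (suc k ∸ j)) ≡ 0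
    row₀-vanishes m k lt = sum-zero (suc k) λ
      { zero    _ → *-≡0ʳ (S 0 0) (T-vanishes m (suc k) lt)
      ; (suc j) _ → cong (_* T m (k ∸ j)) (q⁰-constant j)
      }
    shift′ : ∀ n k → a * n ≤ b * k → (S ⊛ T) (suc n) (suc k) ≡ (S ⊛ T) n k
    shift′ n k an≤bk = begin
      (S ⊛ T) (suc n) (suc k)
        ≡⟨ sum-head n _ ⟩
      sumTo (suc k) (λ j → S 0 j * T (suc n) (suc k ∸ j))
        + sumTo n (λ i → sumTo (suc k) (λ j → S (suc i) j * T (n ∸ i) (suc k ∸ j)))
        ≡⟨ cong₂ _+_ (row₀-vanishes (suc n) k shifted-below)
                     (sum-cong n λ i i≤n → trans (sum-head k _) (cong₂ _+_ (column₀-vanishes i i≤n)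
                                                                           (sum-cong k (shifted-term i i≤n)))) ⟩
      (S ⊛ T) n k
        ∎
      where
      open ≡-Reasoning
      shifted-below : a * suc n < b * suc k
      shifted-below = subst₂ _<_ (sym (*-suc a n)) (sym (*-suc b k)) (+-mono-<-≤ a<b an≤bk)
      column₀-vanishes : ∀ i → i ≤ n → S (suc i) 0 * T (n ∸ i) (suc k) ≡ 0
      column₀-vanishes i i≤n = *-≡0ʳ (S (suc i) 0) (T-vanishes (n ∸ i) (suc k) below)
        where
        below : a * (n ∸ i) < b * suc k
        below = ≤-<-trans (*-monoʳ-≤ a (m∸n≤m n i)) (≤-<-trans an≤bk (b*k<b*[1+k] k))
      shifted-term : ∀ i → i ≤ n → ∀ j → j ≤ k →
                     S (suc i) (suc j) * T (n ∸ i) (k ∸ j) ≡ S i j * T (n ∸ i) (k ∸ j)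
      shifted-term i i≤n j j≤k with a * (n ∸ i) <? b * (k ∸ j)
      ... | yes above = trans (*-≡0ʳ (S (suc i) (suc j)) (T-vanishes _ _ above))
                              (sym (*-≡0ʳ (S i j) (T-vanishes _ _ above)))
      ... | no ¬above = cong (_* T (n ∸ i) (k ∸ j)) (shift i j ai≤bj)
        where
        ai≤bj : a * i ≤ b * j
        ai≤bj = m+n≤o+p⇒p≤n⇒m≤o _ _ _ _ (subst₂ _≤_ (*-split a i≤n) (*-split b j≤k) an≤bk) (≮⇒≥ ¬above)

  shiftStable-resp : ∀ {S S′} → S ≗₂ S′ → ShiftStable S → ShiftStable S′
  shiftStable-resp S≗S′ S-stable = record
    { shift       = λ n k le → trans (sym (S≗S′ (suc n) (suc k))) (trans (shift n k le) (S≗S′ n k))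
    ; q⁰-constant = λ k → trans (sym (S≗S′ 0 (suc k))) (q⁰-constant k)
    }
    where open ShiftStable S-stable

IsOneModQ : ℕ → Series → Set
IsOneModQ m S = ∀ n k → n < m → S n k ≡ one n k

⊛-isOneModQ : ∀ {m S T} → IsOneModQ m S → IsOneModQ m T → IsOneModQ m (S ⊛ T)
⊛-isOneModQ {m} {S} {T} S≡1 T≡1 n k n<m =
  trans (sum-cong n λ i i≤n → sum-cong k λ j _ →
           cong₂ _*_ (S≡1 i j (≤-<-trans i≤n n<m)) (T≡1 (n ∸ i) (k ∸ j) (≤-<-trans (m∸n≤m n i) n<m)))
        (⊛-identityˡ one n k)

pow-isOneModQ : ∀ {m S} → IsOneModQ m S → ∀ e → IsOneModQ m (pow S e)
pow-isOneModQ S≡1 zero    _ _ _ = refl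
pow-isOneModQ S≡1 (suc e)       = ⊛-isOneModQ S≡1 (pow-isOneModQ S≡1 e)

onePlusZQ-isOneModQ : ∀ m → IsOneModQ m (onePlusZQ m)
onePlusZQ-isOneModQ m n k n<m =
  trans (cong (_ +_) (indicator-∧-absurd (n ≟ m) (k ≟ 1) λ n≡m _ → <⇒≢ n<m n≡m))
        (trans (+-identityʳ _) (indicator-origin≡one n k))

invOneMinus-isOneModQ : ∀ m d → IsOneModQ m (invOneMinus m d)
invOneMinus-isOneModQ m d n k n<m =
  trans (sum-head-only n _ λ t _ → indicator-∧-absurd (n ≟ m * suc t) (k ≟ d * suc t)
                                     λ n≡m[1+t] _ → <⇒≢ (<-≤-trans n<m (m≤m*n m (suc t))) n≡m[1+t])
        j₀-term
  where
  j₀-term : (if ⌊ n ≟ m * 0 ⌋ ∧ ⌊ k ≟ d * 0 ⌋ then 1 else 0) ≡ one n k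
  j₀-term rewrite *-zeroʳ m | *-zeroʳ d = indicator-origin≡one n k

factor-isOneModQ : ∀ m → IsOneModQ m (factor m)
factor-isOneModQ m = ⊛-isOneModQ (⊛-isOneModQ (pow-isOneModQ (onePlusZQ-isOneModQ m) m)
                                              (pow-isOneModQ (invOneMinus-isOneModQ m 0) ⌈ m /2⌉))
                                 (pow-isOneModQ (invOneMinus-isOneModQ m 2) ⌊ m /2⌋)

⊛-isOneModQ-coeff : ∀ {m S T} → IsOneModQ m T → ∀ n k → n < m → (S ⊛ T) n k ≡ S n k
⊛-isOneModQ-coeff {S = S} T≡1 n k n<m =
  trans (sum-cong′ n λ i → sum-cong′ k λ j → cong (S i j *_) (T≡1 (n ∸ i) (k ∸ j) (≤-<-trans (m∸n≤m n i) n<m)))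
        (⊛-identityʳ S n k)

prod-coeff-stable : ∀ N n k → n ≤ N → prod (suc N) factor n k ≡ prod N factor n k
prod-coeff-stable N n k n≤N = ⊛-isOneModQ-coeff {S = prod N factor} (factor-isOneModQ (suc N)) n k (s≤s n≤N)

open Slope 2 3

inv[1-z²q²] : Series
inv[1-z²q²] = invOneMinus 2 2

inv[1-z²q²]-q⁰ : ∀ k → inv[1-z²q²] 0 k ≡ one 0 k
inv[1-z²q²]-q⁰ zero    = refl
inv[1-z²q²]-q⁰ (suc k) = refl

inv[1-z²q²]-z⁰ : ∀ n → inv[1-z²q²] (suc n) 0 ≡ 0
inv[1-z²q²]-z⁰ n = sum-zero (suc n) λ t _ →
  indicator-∧-absurd (suc n ≟ 2 * t) (0 ≟ 2 * t) λ 1+n≡2t 0≡2t → 1+n≢0 (trans 1+n≡2t (sym 0≡2t))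

inv[1-z²q²]-z¹ : ∀ n → inv[1-z²q²] n 1 ≡ 0
inv[1-z²q²]-z¹ n = sum-zero n λ t _ → indicator-∧-absurd (n ≟ 2 * t) (1 ≟ 2 * t) λ _ → 1≢2t t
  where
  1≢2t : ∀ t → 1 ≢ 2 * t
  1≢2t zero    ()
  1≢2t (suc t) 1≡2+2t with trans (suc-injective 1≡2+2t) (+-suc t (t + 0))
  ... | ()

inv[1-z²q²]-shift² : ∀ n k → inv[1-z²q²] (suc (suc n)) (suc (suc k)) ≡ inv[1-z²q²] n k
inv[1-z²q²]-shift² n k = begin
  inv[1-z²q²] (suc (suc n)) (suc (suc k))
    ≡⟨ sum-head (suc n) _ ⟩
  sumTo (suc n) (λ t → if ⌊ suc (suc n) ≟ 2 * suc t ⌋ ∧ ⌊ suc (suc k) ≟ 2 * suc t ⌋ then 1 else 0)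
    ≡⟨ sum-cong′ (suc n) (λ t → cong₂ (λ x y → if x ∧ y then 1 else 0) (⌊2+m≟2[1+t]⌋ n t) (⌊2+m≟2[1+t]⌋ k t)) ⟩
  inv[1-z²q²] n k + (if ⌊ n ≟ 2 * suc n ⌋ ∧ ⌊ k ≟ 2 * suc n ⌋ then 1 else 0)
    ≡⟨ cong (inv[1-z²q²] n k +_)
            (indicator-∧-absurd (n ≟ 2 * suc n) (k ≟ 2 * suc n) λ n≡2+2n _ → <⇒≢ n<2+2n n≡2+2n) ⟩
  inv[1-z²q²] n k + 0
    ≡⟨ +-identityʳ _ ⟩
  inv[1-z²q²] n k
    ∎
  where
  open ≡-Reasoning
  ⌊2+m≟2[1+t]⌋ : ∀ m t → ⌊ suc (suc m) ≟ 2 * suc t ⌋ ≡ ⌊ m ≟ 2 * t ⌋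
  ⌊2+m≟2[1+t]⌋ m t = trans (cong (λ x → ⌊ suc (suc m) ≟ x ⌋) (*-suc 2 t))
                           (trans (⌊suc≟suc⌋ (suc m) (suc (2 * t))) (⌊suc≟suc⌋ m (2 * t)))
  n<2+2n : n < 2 * suc n
  n<2+2n = s≤s (m≤m+n n (suc (n + 0)))

-- (1 + zq)/(1 - z²q²) = 1/(1 - zq), so its coefficients are constant along every diagonal.
[1+zq]/[1-z²q²] : Series
[1+zq]/[1-z²q²] = onePlusZQ 1 ⊛ inv[1-z²q²]

[1+zq]/[1-z²q²]-q⁰-row : ∀ n k → sumTo k (λ j → onePlusZQ 1 0 j * inv[1-z²q²] n (k ∸ j)) ≡ inv[1-z²q²] n k
[1+zq]/[1-z²q²]-q⁰-row n k = trans (sum-head-only k _ λ _ _ → refl) (+-identityʳ _)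

1+zq-z⁰-term : ∀ i x → onePlusZQ 1 (suc i) 0 * x ≡ 0
1+zq-z⁰-term i x = cong (_* x) (indicator-∧-absurd (suc i ≟ 1) (0 ≟ 1) λ _ ())

[1+zq]/[1-z²q²]-z⁰ : ∀ n → [1+zq]/[1-z²q²] (suc n) 0 ≡ inv[1-z²q²] (suc n) 0
[1+zq]/[1-z²q²]-z⁰ n =
  trans (sum-head-only (suc n) _ λ i _ → 1+zq-z⁰-term i _)
        ([1+zq]/[1-z²q²]-q⁰-row (suc n) 0)

[1+zq]/[1-z²q²]-split : ∀ n k →
  [1+zq]/[1-z²q²] (suc n) (suc k) ≡ inv[1-z²q²] (suc n) (suc k) + inv[1-z²q²] n k
[1+zq]/[1-z²q²]-split n k =
  trans (sum-head n _)
        (cong₂ _+_ ([1+zq]/[1-z²q²]-q⁰-row (suc n) (suc k))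
                   (trans (sum-cong′ n λ i → trans (sum-head k _)
                            (cong₂ _+_ (1+zq-z⁰-term i _)
                                       (sum-cong′ k λ j → cong (_* inv[1-z²q²] (n ∸ i) (k ∸ j)) (zq-coeff i j))))
                          (⊛-identityˡ inv[1-z²q²] n k)))
  where
  zq-coeff : ∀ i j → onePlusZQ 1 (suc i) (suc j) ≡ one i j
  zq-coeff i j rewrite ⌊suc≟suc⌋ i 0 | ⌊suc≟suc⌋ j 0 = indicator-origin≡one i j

[1+zq]/[1-z²q²]-shift : ∀ n k → [1+zq]/[1-z²q²] (suc n) (suc k) ≡ [1+zq]/[1-z²q²] n k
[1+zq]/[1-z²q²]-shift zero k =
  trans ([1+zq]/[1-z²q²]-split 0 k) (sym ([1+zq]/[1-z²q²]-q⁰-row 0 k))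
[1+zq]/[1-z²q²]-shift (suc n) zero =
  trans ([1+zq]/[1-z²q²]-split (suc n) 0)
        (trans (cong₂ _+_ (inv[1-z²q²]-z¹ (suc (suc n))) (inv[1-z²q²]-z⁰ n))
               (sym (trans ([1+zq]/[1-z²q²]-z⁰ n) (inv[1-z²q²]-z⁰ n))))
[1+zq]/[1-z²q²]-shift (suc n) (suc k) =
  trans ([1+zq]/[1-z²q²]-split (suc n) (suc k))
        (trans (cong (_+ inv[1-z²q²] (suc n) (suc k)) (inv[1-z²q²]-shift² n k))
               (trans (+-comm (inv[1-z²q²] n k) _) (sym ([1+zq]/[1-z²q²]-split n k))))

[1+zq]/[1-z²q²]-shiftStable : ShiftStable [1+zq]/[1-z²q²]
[1+zq]/[1-z²q²]-shiftStable = record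
  { shift       = λ n k _ → [1+zq]/[1-z²q²]-shift n k
  ; q⁰-constant = λ k → trans ([1+zq]/[1-z²q²]-q⁰-row 0 (suc k)) (inv[1-z²q²]-q⁰ (suc k))
  }

[1+zq²]²/[1-q][1-q²] : Series
[1+zq²]²/[1-q][1-q²] = invOneMinus 1 0 ⊛ (pow (onePlusZQ 2) 2 ⊛ pow (invOneMinus 2 0) 1)

[1+zq²]²/[1-q][1-q²]-vanishesAbove : VanishesAbove [1+zq²]²/[1-q][1-q²]
[1+zq²]²/[1-q][1-q²]-vanishesAbove =
  ⊛-vanishesAbove (invOneMinus-vanishesAbove 1 0 z≤n)
                  (⊛-vanishesAbove (pow-vanishesAbove (onePlusZQ-vanishesAbove 2 (s≤s (s≤s (s≤s z≤n)))) 2)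
                                   (pow-vanishesAbove (invOneMinus-vanishesAbove 2 0 z≤n) 1))

prod₂-split : prod 2 factor ≗₂ [1+zq]/[1-z²q²] ⊛ [1+zq²]²/[1-q][1-q²]
prod₂-split = prove 5 ((id ⊕ (((x₁ ⊕ id) ⊕ (y₁ ⊕ id)) ⊕ id)) ⊕ ((x₂ ⊕ (y₂ ⊕ id)) ⊕ (z ⊕ id)))
                      ((x₁ ⊕ z) ⊕ (y₁ ⊕ (x₂ ⊕ (y₂ ⊕ id))))
                      (onePlusZQ 1 ∷ invOneMinus 1 0 ∷ pow (onePlusZQ 2) 2 ∷ invOneMinus 2 0 ∷ inv[1-z²q²] ∷ [])
  where
  open CommutativeMonoidSolver ⊛-commutativeMonoid
  x₁ y₁ x₂ y₂ z : Expr 5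
  x₁ = var zero
  y₁ = var (suc zero)
  x₂ = var (suc (suc zero))
  y₂ = var (suc (suc (suc zero)))
  z  = var (suc (suc (suc (suc zero))))

2<3 : 2 < 3
2<3 = s≤s (s≤s (s≤s z≤n))

prod-shiftStable : ∀ m → ShiftStable (prod (suc (suc m)) factor)
prod-shiftStable zero    = shiftStable-resp (λ n k → sym (prod₂-split n k))
                             (⊛-shiftStable 2<3 [1+zq]/[1-z²q²]-shiftStable [1+zq²]²/[1-q][1-q²]-vanishesAbove)
prod-shiftStable (suc m) = ⊛-shiftStable 2<3 (prod-shiftStable m)
                             (factor-vanishesAbove (3 + m) (*-monoʳ-≤ 2 (s≤s (s≤s (s≤s z≤n)))))

theorem12 : (n k : ℕ) → 2 * n ≤ 3 * k → coeffF (suc n) (suc k) ≡ coeffF n k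
theorem12 n k 2n≤3k = begin
  prod (suc n) factor (suc n) (suc k)        ≡⟨ prod-coeff-stable (suc n) (suc n) (suc k) ≤-refl ⟨
  prod (suc (suc n)) factor (suc n) (suc k)  ≡⟨ ShiftStable.shift (prod-shiftStable n) n k 2n≤3k ⟩
  prod (suc (suc n)) factor n k              ≡⟨ prod-coeff-stable (suc n) n k (n≤1+n n) ⟩
  prod (suc n) factor n k                    ≡⟨ prod-coeff-stable n n k ≤-refl ⟩
  prod n factor n k                          ∎
  where open ≡-Reasoning
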